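{- Let $k,l$ be positive integers and $i,j$ nonnegative integers. The matroid $U_{i,i}\oplus U_{0,j}$ (consisting of $i$ coloops and $j$ loops) is not almost $(k,l)$-uniform if and only if $(i,j)>(k,l)$.
   Context: $(i,j)>(k,l)$ means $i\ge k$, $j\ge l$ and $(i,j)\neq(k,l)$. A matroid is $(k,l)$-uniform if it has no minor isomorphic to $U_{k,k}\oplus U_{0,l}$. A matroid $M$ is almost $(k,l)$-uniform if for every element $v$, at least one of $M-v$ or $M/v$ is $(k,l)$-uniform. -}

module Defs where

open import Data.Nat using (ℕ; _≤_; _+_)
open import Data.Fin using (Fin)
open import Data.Fin.Subset using (Subset; _∈_; _∉_; _⊆_; _⊂_; _∪_; _─_; ∣_∣; ⁅_⁆; ⊤)
open import Data.Vec using (_++_; take; drop; tabulate; lookup)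
open import Data.Product using (Σ; ∃; _×_; _,_)
open import Data.Sum using (_⊎_)
open import Function.Definitions using (Injective)
open import Function.Bundles using (_⇔_)
open import Relation.Binary.PropositionalEquality using (_≡_)
open import Relation.Nullary using (¬_)

-- Ind is only meaningful on subsets of E (every notion below
-- restricts to subsets of E).  The matroid axioms are not bundled: the only
-- matroids the theorem is about are the concrete U_{i,i} ⊕ U_{0,j} and their
-- minors, which are matroids.
record PreMatroid (n : ℕ) : Set₁ where
  field
    E   : Subset n
    Ind : Subset n → Set
open PreMatroid public

U : (r m : ℕ) → PreMatroid m
U r m = record { E = ⊤ ; Ind = λ X → ∣ X ∣ ≤ r }

_⊕_ : {a b : ℕ} → PreMatroid a → PreMatroid b → PreMatroid (a + b)
_⊕_ {a} {b} M N = record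
  { E   = E M ++ E N
  ; Ind = λ X → Ind M (take a X) × Ind N (drop a X) }

_∖_ : {n : ℕ} → PreMatroid n → Subset n → PreMatroid n
M ∖ D = record
  { E   = E M ─ D
  ; Ind = λ X → X ⊆ (E M ─ D) × Ind M X }

IsBasisOf : {n : ℕ} → PreMatroid n → Subset n → Subset n → Set
IsBasisOf M C B = B ⊆ C × Ind M B × (∀ Y → B ⊂ Y → Y ⊆ C → ¬ Ind M Y)

-- Contraction M / C: X ⊆ E - C is independent iff X ∪ B is independent in M
-- for a basis B of C (for a matroid, independent of the choice of B).
_/_ : {n : ℕ} → PreMatroid n → Subset n → PreMatroid n
M / C = record
  { E   = E M ─ C
  ; Ind = λ X → X ⊆ (E M ─ C) × ∃ λ B → IsBasisOf M C B × Ind M (X ∪ B) }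

preimage : {m n : ℕ} → (Fin m → Fin n) → Subset n → Subset m
preimage f X = tabulate (λ y → lookup X (f y))

-- M (ground set E M ⊆ Fin n) is isomorphic to N, where N has full ground
-- set Fin m: a bijection f : Fin m → E M preserving independence.
IsoTo : {n m : ℕ} → PreMatroid n → PreMatroid m → Set
IsoTo {n} {m} M N =
  Σ (Fin m → Fin n) λ f →
    Injective _≡_ _≡_ f ×
    (∀ x → (x ∈ E M) ⇔ (∃ λ y → f y ≡ x)) ×
    (∀ X → X ⊆ E M → (Ind M X ⇔ Ind N (preimage f X)))

HasMinor : {n m : ℕ} → PreMatroid n → PreMatroid m → Set
HasMinor M N = ∃ λ C → ∃ λ D →
  C ⊆ E M × D ⊆ E M × (∀ x → x ∈ C → x ∉ D) × IsoTo ((M / C) ∖ D) N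

Uniform : (k l : ℕ) → {n : ℕ} → PreMatroid n → Set
Uniform k l M = ¬ HasMinor M (U k k ⊕ U 0 l)

AlmostUniform : (k l : ℕ) → {n : ℕ} → PreMatroid n → Set
AlmostUniform k l M =
  ∀ v → v ∈ E M → Uniform k l (M ∖ ⁅ v ⁆) ⊎ Uniform k l (M / ⁅ v ⁆)

_>₂_ : ℕ × ℕ → ℕ × ℕ → Set
(i , j) >₂ (k , l) = k ≤ i × l ≤ j × ¬ (i ≡ k × j ≡ l)

-- Minors of U_{i,i} ⊕ U_{0,j} keep this shape (coloops stay coloops, loops stay
-- loops), so a minor isomorphic to U_{k,k} ⊕ U_{0,l} amounts to an injection sending
-- the k coloops to coloops and the l loops to loops.  A minor of M \ v misses v,
-- which forces k ≤ i, l ≤ j and k + l < i + j, that is (i,j) > (k,l); so when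
-- (i,j) > (k,l) fails, every M \ v is (k,l)-uniform.  When (i,j) > (k,l), pick v
-- outside the image of such an injection: both M \ v and M / v then keep the minor.
module Submission where

open import Defs
open import Data.Nat using (ℕ; _≤_)
open import Data.Product using (_,_)
open import Function.Bundles using (_⇔_)
open import Relation.Nullary using (¬_)

open import Data.Empty using (⊥-elim)
open import Data.Fin as Fin using (Fin; _↑ˡ_; _↑ʳ_; splitAt; join; inject≤; fromℕ<; toℕ)
open import Data.Fin.Properties
  using (any?; ↑ˡ-injective; ↑ʳ-injective; splitAt⁻¹-↑ˡ; splitAt⁻¹-↑ʳ; splitAt-↑ˡ; splitAt-↑ʳ; splitAt-join; join-splitAt;
         injective⇒≤; punchOut-injective; toℕ-inject≤; toℕ-fromℕ<; toℕ<n; inject≤-injective)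
open import Data.Fin.Subset using (Subset; Side; inside; Empty; _∈_; _∉_; _⊆_; _∪_; _∩_; _─_; ∣_∣; ⁅_⁆; ⊤; ⊥)
open import Data.Fin.Subset.Properties
open import Data.Nat using (_<_; _+_; _<?_; _≤?_; _≟_; s≤s)
open import Data.Nat.Properties using (≤-reflexive; ≤-trans; <-irrefl; <⇒≤; <⇒≢; ≮⇒≥; ≤∧≢⇒<; ≤-antisym)
open import Data.Product using (Σ; ∃; _×_; proj₁; proj₂)
open import Data.Sum as Sum using (inj₁; inj₂; [_,_]′)
open import Data.Sum.Properties using (inj₁-injective; inj₂-injective)
open import Data.Vec using (_∷_; _++_; take; drop; tabulate; here; there)
open import Data.Vec.Properties using (lookup∘tabulate; []=⇒lookup; lookup⇒[]=)
open import Function using (_∘_; id)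
open import Function.Bundles using (mk⇔; Equivalence)
open import Function.Definitions using (Injective)
import Function.Properties.Equivalence as Equiv
open import Function.Related.Propositional as Related using ()
open import Relation.Binary.PropositionalEquality
open import Relation.Nullary using (Dec; yes; no; does; _×-dec_; ¬?)
open import Relation.Nullary.Decidable using (decidable-stable; dec-true)

open Equivalence using (to; from)

data SplitView (m n : ℕ) : Fin (m + n) → Set where
  left  : (a : Fin m) → SplitView m n (a ↑ˡ n)
  right : (b : Fin n) → SplitView m n (m ↑ʳ b)

splitView : ∀ m n (x : Fin (m + n)) → SplitView m n x
splitView m n x with splitAt m x in eq
... | inj₁ a = subst (SplitView m n) (splitAt⁻¹-↑ˡ eq) (left a)
... | inj₂ b = subst (SplitView m n) (splitAt⁻¹-↑ʳ eq) (right b)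

injective-avoiding⇒< : ∀ {m n} {f : Fin m → Fin n} {v : Fin n} →
  Injective _≡_ _≡_ f → (∀ x → f x ≢ v) → m < n
injective-avoiding⇒< {n = ℕ.suc _} f-inj f≢v =
  s≤s (injective⇒≤ (λ eq → f-inj (punchOut-injective (f≢v _ ∘ sym) (f≢v _ ∘ sym) eq)))

⊎-map-injective : ∀ {A B C D : Set} {g : A → C} {h : B → D} →
  Injective _≡_ _≡_ g → Injective _≡_ _≡_ h → Injective _≡_ _≡_ (Sum.map g h)
⊎-map-injective g-inj h-inj {inj₁ _} {inj₁ _} eq = cong inj₁ (g-inj (inj₁-injective eq))
⊎-map-injective g-inj h-inj {inj₂ _} {inj₂ _} eq = cong inj₂ (h-inj (inj₂-injective eq))

∈-tabulate : ∀ {n} {g : Fin n → Side} {x} → x ∈ tabulate g ⇔ g x ≡ inside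
∈-tabulate {g = g} {x} = mk⇔
  (λ x∈ → trans (sym (lookup∘tabulate g x)) ([]=⇒lookup x∈))
  (λ gx≡ → lookup⇒[]= x _ (trans (lookup∘tabulate g x) gx≡))

∈-preimage : ∀ {m n} {f : Fin m → Fin n} {X y} → y ∈ preimage f X ⇔ f y ∈ X
∈-preimage {f = f} {X} {y} = mk⇔
  (λ y∈ → lookup⇒[]= (f y) X (to ∈-tabulate y∈))
  (λ fy∈ → from ∈-tabulate ([]=⇒lookup fy∈))

image : ∀ {m n} → (Fin m → Fin n) → Subset n
image f = tabulate λ x → does (any? λ y → f y Fin.≟ x)

∈-image : ∀ {m n} {f : Fin m → Fin n} {x} → x ∈ image f ⇔ ∃ λ y → f y ≡ x
∈-image {f = f} {x} = mk⇔ fromImage (λ fy≡x → from ∈-tabulate (dec-true x∈image? fy≡x))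
  where
  x∈image? = any? λ y → f y Fin.≟ x
  fromImage : x ∈ image f → ∃ λ y → f y ≡ x
  fromImage x∈ with x∈image? | to ∈-tabulate x∈
  ... | yes fy≡x | _ = fy≡x
  ... | no _ | ()

x∈p─q⇒x∉q : ∀ {n} (p q : Subset n) {x} → x ∈ p ─ q → x ∉ q
x∈p─q⇒x∉q (_ ∷ p) (inside ∷ q) {Fin.zero} ()
x∈p─q⇒x∉q (_ ∷ p) (_ ∷ q) (there x∈) (there y∈) = x∈p─q⇒x∉q p q x∈ y∈

x∈p∧x∉p─q⇒x∈q : ∀ {n} {p q : Subset n} {x} → x ∈ p → x ∉ p ─ q → x ∈ q
x∈p∧x∉p─q⇒x∈q {q = q} {x} x∈p x∉p─q with x ∈? q
... | yes x∈q = x∈q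
... | no x∉q = ⊥-elim (x∉p─q (x∈p∧x∉q⇒x∈p─q x∈p x∉q))

∪-lub : ∀ {n} {p q r : Subset n} → p ⊆ r → q ⊆ r → p ∪ q ⊆ r
∪-lub {p = p} {q} p⊆r q⊆r x∈ = [ p⊆r , q⊆r ]′ (x∈p∪q⁻ p q x∈)

∩-glb : ∀ {n} {p q r : Subset n} → r ⊆ p → r ⊆ q → r ⊆ p ∩ q
∩-glb r⊆p r⊆q x∈ = x∈p∩q⁺ (r⊆p x∈ , r⊆q x∈)

⁅x⁆⊆p⇔x∈p : ∀ {n} {p : Subset n} {x} → ⁅ x ⁆ ⊆ p ⇔ x ∈ p
⁅x⁆⊆p⇔x∈p {p = p} {x} = mk⇔
  (λ ⁅x⁆⊆p → ⁅x⁆⊆p (x∈⁅x⁆ x))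
  (λ x∈p {y} y∈ → subst (_∈ p) (sym (x∈⁅y⁆⇒x≡y x y∈)) x∈p)

∣p∣≤0⇔Empty : ∀ {n} {p : Subset n} → ∣ p ∣ ≤ 0 ⇔ Empty p
∣p∣≤0⇔Empty {n} {p} = mk⇔ ≤0⇒empty (λ empty →
  subst (λ q → ∣ q ∣ ≤ 0) (sym (Empty-unique empty)) (≤-reflexive (∣⊥∣≡0 n)))
  where
  ≤0⇒empty : ∣ p ∣ ≤ 0 → Empty p
  ≤0⇒empty ∣p∣≤0 (x , x∈p)
    with ≤-trans (≤-reflexive (sym (∣⁅x⁆∣≡1 x)))
                 (≤-trans (p⊆q⇒∣p∣≤∣q∣ (from ⁅x⁆⊆p⇔x∈p x∈p)) ∣p∣≤0)
  ... | ()

∈-drop : ∀ m {n} (X : Subset (m + n)) {b} → b ∈ drop m X ⇔ m ↑ʳ b ∈ X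
∈-drop ℕ.zero X = mk⇔ id id
∈-drop (ℕ.suc m) (_ ∷ X) = mk⇔ (there ∘ to (∈-drop m X)) (from (∈-drop m X) ∘ drop-there)

coloopsLoops : ∀ i j → PreMatroid (i + j)
coloopsLoops i j = U i i ⊕ U 0 j

coloops : ∀ i j → Subset (i + j)
coloops i j = ⊤ {i} ++ ⊥ {j}

↑ˡ∈coloops : ∀ {i} j (a : Fin i) → a ↑ˡ j ∈ coloops i j
↑ˡ∈coloops j Fin.zero = here
↑ˡ∈coloops j (Fin.suc a) = there (↑ˡ∈coloops j a)

↑ʳ∉coloops : ∀ i {j} (b : Fin j) → i ↑ʳ b ∉ coloops i j
↑ʳ∉coloops ℕ.zero b = ∉⊥
↑ʳ∉coloops (ℕ.suc i) b (there b∈) = ↑ʳ∉coloops i b b∈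

∈coloops⇒≡↑ˡ : ∀ {i j x} → x ∈ coloops i j → ∃ λ a → x ≡ a ↑ˡ j
∈coloops⇒≡↑ˡ {i} {j} {x} x∈ with splitView i j x
... | left a = a , refl
... | right b = ⊥-elim (↑ʳ∉coloops i b x∈)

∉coloops⇒≡↑ʳ : ∀ {i j x} → x ∉ coloops i j → ∃ λ b → x ≡ i ↑ʳ b
∉coloops⇒≡↑ʳ {i} {j} {x} x∉ with splitView i j x
... | left a = ⊥-elim (x∉ (↑ˡ∈coloops j a))
... | right b = b , refl

∈-E-coloopsLoops : ∀ i j (x : Fin (i + j)) → x ∈ E (coloopsLoops i j)
∈-E-coloopsLoops ℕ.zero j x = ∈⊤
∈-E-coloopsLoops (ℕ.suc i) j Fin.zero = here
∈-E-coloopsLoops (ℕ.suc i) j (Fin.suc x) = there (∈-E-coloopsLoops i j x)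

ind-coloopsLoops⇔ : ∀ i j X → Ind (coloopsLoops i j) X ⇔ X ⊆ coloops i j
ind-coloopsLoops⇔ i j X = mk⇔
  (λ (_ , ∣drop∣≤0) {x} x∈ → noLoop (to ∣p∣≤0⇔Empty ∣drop∣≤0) x x∈)
  (λ X⊆ → ∣p∣≤n (take i X) , from ∣p∣≤0⇔Empty (λ (b , b∈) → ↑ʳ∉coloops i b (X⊆ (to (∈-drop i X) b∈))))
  where
  noLoop : Empty (drop i X) → ∀ x → x ∈ X → x ∈ coloops i j
  noLoop empty x x∈ with splitView i j x
  ... | left a = ↑ˡ∈coloops j a
  ... | right b = ⊥-elim (empty (b , from (∈-drop i X) x∈))

record ColoopsLoopsRestriction (i j : ℕ) (P : PreMatroid (i + j)) : Set where
  constructor restriction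
  field ind⇔⊆coloops : ∀ X → X ⊆ E P → Ind P X ⇔ X ⊆ coloops i j

open ColoopsLoopsRestriction

coloopsLoops-restriction : ∀ i j → ColoopsLoopsRestriction i j (coloopsLoops i j)
coloopsLoops-restriction i j = restriction λ X _ → ind-coloopsLoops⇔ i j X

∖-restriction : ∀ {i j P} → ColoopsLoopsRestriction i j P → ∀ D → ColoopsLoopsRestriction i j (P ∖ D)
∖-restriction {i} {j} {P} R D = restriction ind⇔
  where
  ind⇔ : ∀ X → X ⊆ E P ─ D → Ind (P ∖ D) X ⇔ X ⊆ coloops i j
  ind⇔ X X⊆ = mk⇔ (to R[X] ∘ proj₂) (λ X⊆coloops → (λ {_} → X⊆) , from R[X] X⊆coloops)
    where R[X] = ind⇔⊆coloops R X (⊆-trans X⊆ (p─q⊆p (E P) D))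

∩coloops-isBasis : ∀ {i j P C} → ColoopsLoopsRestriction i j P → C ⊆ E P →
  IsBasisOf P C (C ∩ coloops i j)
∩coloops-isBasis {i} {j} {P} {C} R C⊆ =
  p∩q⊆p C (coloops i j) ,
  from (ind⇔⊆coloops R _ (⊆-trans (p∩q⊆p C _) C⊆)) (p∩q⊆q C _) ,
  λ Y B⊂Y Y⊆C indY →
    ⊂-irref refl (⊂-⊆-trans B⊂Y (∩-glb Y⊆C (to (ind⇔⊆coloops R Y (⊆-trans Y⊆C C⊆)) indY)))

-- Contracting C amounts to deleting it, because C ∩ coloops is a basis of C.
/-restriction : ∀ {i j P C} → ColoopsLoopsRestriction i j P → C ⊆ E P →
  ColoopsLoopsRestriction i j (P / C)
/-restriction {i} {j} {P} {C} R C⊆ = restriction ind⇔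
  where
  ind⇔ : ∀ X → X ⊆ E P ─ C → Ind (P / C) X ⇔ X ⊆ coloops i j
  ind⇔ X X⊆ = mk⇔
    (λ (_ , B , (B⊆C , _) , indX∪B) →
       ⊆-trans (p⊆p∪q B) (to (ind⇔⊆coloops R _ (∪-lub X⊆E (⊆-trans B⊆C C⊆))) indX∪B))
    (λ (X⊆coloops : X ⊆ coloops i j) → (λ {_} → X⊆) , C ∩ coloops i j , ∩coloops-isBasis R C⊆ ,
       from (ind⇔⊆coloops R _ (∪-lub X⊆E (⊆-trans (p∩q⊆p C _) C⊆))) (∪-lub X⊆coloops (p∩q⊆q C _)))
    where X⊆E = ⊆-trans X⊆ (p─q⊆p (E P) C)

record ColoopsLoopsEmbedding (k l i j : ℕ) : Set where
  field
    embed             : Fin (k + l) → Fin (i + j)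
    injective         : Injective _≡_ _≡_ embed
    preserves-coloops : ∀ y → embed y ∈ coloops i j ⇔ y ∈ coloops k l

open ColoopsLoopsEmbedding

embedding⇒≤ : ∀ {k l i j} → ColoopsLoopsEmbedding k l i j → k ≤ i × l ≤ j
embedding⇒≤ {k} {l} {i} {j} e =
  injective⇒≤ (λ {a} {a'} eq → ↑ˡ-injective l a a' (injective e (begin
    embed e (a ↑ˡ l)             ≡⟨ proj₂ (onColoops a) ⟩
    proj₁ (onColoops a) ↑ˡ j     ≡⟨ cong (_↑ˡ j) eq ⟩
    proj₁ (onColoops a') ↑ˡ j    ≡⟨ sym (proj₂ (onColoops a')) ⟩
    embed e (a' ↑ˡ l)            ∎))) ,
  injective⇒≤ (λ {b} {b'} eq → ↑ʳ-injective k b b' (injective e (begin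
    embed e (k ↑ʳ b)             ≡⟨ proj₂ (onLoops b) ⟩
    i ↑ʳ proj₁ (onLoops b)       ≡⟨ cong (i ↑ʳ_) eq ⟩
    i ↑ʳ proj₁ (onLoops b')      ≡⟨ sym (proj₂ (onLoops b')) ⟩
    embed e (k ↑ʳ b')            ∎)))
  where
  open ≡-Reasoning
  onColoops : ∀ a → ∃ λ a' → embed e (a ↑ˡ l) ≡ a' ↑ˡ j
  onColoops a = ∈coloops⇒≡↑ˡ (from (preserves-coloops e _) (↑ˡ∈coloops l a))
  onLoops : ∀ b → ∃ λ b' → embed e (k ↑ʳ b) ≡ i ↑ʳ b'
  onLoops b = ∉coloops⇒≡↑ʳ (↑ʳ∉coloops k b ∘ to (preserves-coloops e _))

embedding-⊆coloops⇔ : ∀ {k l i j} (e : ColoopsLoopsEmbedding k l i j) {X} →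
  X ⊆ image (embed e) → X ⊆ coloops i j ⇔ preimage (embed e) X ⊆ coloops k l
embedding-⊆coloops⇔ {k} {l} {i} {j} e {X} X⊆image = mk⇔
  (λ X⊆ {y} y∈ → to (preserves-coloops e y) (X⊆ (to ∈-preimage y∈)))
  (λ preimage⊆ {x} x∈ → fromPreimage preimage⊆ x∈ (to ∈-image (X⊆image x∈)))
  where
  fromPreimage : preimage (embed e) X ⊆ coloops k l → ∀ {x} → x ∈ X → (∃ λ y → embed e y ≡ x) →
    x ∈ coloops i j
  fromPreimage preimage⊆ x∈ (y , refl) = from (preserves-coloops e y) (preimage⊆ (from ∈-preimage x∈))

preimage-⁅⁆ : ∀ {m n} {f : Fin m → Fin n} → Injective _≡_ _≡_ f → ∀ y → preimage f ⁅ f y ⁆ ≡ ⁅ y ⁆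
preimage-⁅⁆ {f = f} f-inj y = ⊆-antisym
  (λ y'∈ → from x∈⁅y⁆⇔x≡y (f-inj (x∈⁅y⁆⇒x≡y _ (to ∈-preimage y'∈))))
  (λ y'∈ → from ∈-preimage (subst (λ z → f z ∈ ⁅ f y ⁆) (sym (x∈⁅y⁆⇒x≡y y y'∈)) (x∈⁅x⁆ (f y))))

iso⇒embedding : ∀ {i j k l Q} → ColoopsLoopsRestriction i j Q → IsoTo Q (coloopsLoops k l) →
  ColoopsLoopsEmbedding k l i j
iso⇒embedding {i} {j} {k} {l} {Q} R (f , f-inj , f-onto , f-ind) = record
  { embed = f ; injective = f-inj ; preserves-coloops = preserves }
  where
  open Related.EquationalReasoning
  preserves : ∀ y → f y ∈ coloops i j ⇔ y ∈ coloops k l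
  preserves y = begin
    f y ∈ coloops i j                             ∼⟨ Equiv.sym ⁅x⁆⊆p⇔x∈p ⟩
    ⁅ f y ⁆ ⊆ coloops i j                         ∼⟨ Equiv.sym (ind⇔⊆coloops R _ ⁅fy⁆⊆E) ⟩
    Ind Q ⁅ f y ⁆                                 ∼⟨ f-ind ⁅ f y ⁆ ⁅fy⁆⊆E ⟩
    Ind (coloopsLoops k l) (preimage f ⁅ f y ⁆)   ∼⟨ ind-coloopsLoops⇔ k l _ ⟩
    preimage f ⁅ f y ⁆ ⊆ coloops k l              ≡⟨ cong (_⊆ coloops k l) (preimage-⁅⁆ f-inj y) ⟩
    ⁅ y ⁆ ⊆ coloops k l                           ∼⟨ ⁅x⁆⊆p⇔x∈p ⟩
    y ∈ coloops k l                               ∎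
    where ⁅fy⁆⊆E = from ⁅x⁆⊆p⇔x∈p (from (f-onto (f y)) (y , refl))

>₂-intro : ∀ {i j k l} → k ≤ i → l ≤ j → k + l < i + j → (i , j) >₂ (k , l)
>₂-intro k≤i l≤j k+l<i+j = k≤i , l≤j , λ { (refl , refl) → <-irrefl refl k+l<i+j }

_>₂?_ : ∀ p q → Dec (p >₂ q)
(i , j) >₂? (k , l) = k ≤? i ×-dec l ≤? j ×-dec ¬? (i ≟ k ×-dec j ≟ l)

minor⇒>₂ : ∀ {i j k l P v} → ColoopsLoopsRestriction i j P → v ∉ E P →
  HasMinor P (coloopsLoops k l) → (i , j) >₂ (k , l)
minor⇒>₂ {P = P} {v} R v∉E (C , D , C⊆ , _ , _ , iso@(f , f-inj , f-onto , _)) =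
  >₂-intro k≤i l≤j (injective-avoiding⇒< f-inj f≢v)
  where
  bounds = embedding⇒≤ (iso⇒embedding (∖-restriction (/-restriction R C⊆) D) iso)
  k≤i = proj₁ bounds
  l≤j = proj₂ bounds
  f≢v : ∀ y → f y ≢ v
  f≢v y refl = v∉E (p─q⊆p (E P) C (p─q⊆p (E P ─ C) D (from (f-onto (f y)) (y , refl))))

embedding⇒minor : ∀ {i j k l P} → ColoopsLoopsRestriction i j P →
  (e : ColoopsLoopsEmbedding k l i j) → (∀ y → embed e y ∈ E P) → HasMinor P (coloopsLoops k l)
embedding⇒minor {i} {j} {k} {l} {P} R e f∈E =
  ⊥ , D , ⊥⊆ , p─q⊆p (E P) (image f) , (λ _ x∈⊥ → ⊥-elim (∉⊥ x∈⊥)) , f , injective e , onto , ind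
  where
  open Related.EquationalReasoning
  f = embed e
  D = E P ─ image f
  Q = (P / ⊥) ∖ D
  onto : ∀ x → x ∈ E Q ⇔ ∃ λ y → f y ≡ x
  onto x = mk⇔
    (λ x∈ → to ∈-image (x∈p∧x∉p─q⇒x∈q (p─q⊆p (E P) ⊥ (p─q⊆p (E P ─ ⊥) D x∈)) (x∈p─q⇒x∉q _ D x∈)))
    (λ { (y , refl) → x∈p∧x∉q⇒x∈p─q (x∈p∧x∉q⇒x∈p─q (f∈E y) ∉⊥)
                        (λ fy∈D → x∈p─q⇒x∉q (E P) (image f) fy∈D (from ∈-image (y , refl))) })
  ind : ∀ X → X ⊆ E Q → Ind Q X ⇔ Ind (coloopsLoops k l) (preimage f X)
  ind X X⊆ = begin
    Ind Q X                                  ∼⟨ ind⇔⊆coloops (∖-restriction (/-restriction R ⊥⊆) D) X X⊆ ⟩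
    X ⊆ coloops i j                          ∼⟨ embedding-⊆coloops⇔ e (λ x∈ → from ∈-image (to (onto _) (X⊆ x∈))) ⟩
    preimage f X ⊆ coloops k l               ∼⟨ Equiv.sym (ind-coloopsLoops⇔ k l _) ⟩
    Ind (coloopsLoops k l) (preimage f X)    ∎

join-map : ∀ {k l i j} → (Fin k → Fin i) → (Fin l → Fin j) → Fin (k + l) → Fin (i + j)
join-map {k} {l} {i} {j} g h = join i j ∘ Sum.map g h ∘ splitAt k

join-map-embedding : ∀ {k l i j} {g : Fin k → Fin i} {h : Fin l → Fin j} →
  Injective _≡_ _≡_ g → Injective _≡_ _≡_ h → ColoopsLoopsEmbedding k l i j
join-map-embedding {k} {l} {i} {j} {g} {h} g-inj h-inj = record
  { embed = join-map g h ; injective = injective′ ; preserves-coloops = preserves }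
  where
  open ≡-Reasoning
  injective′ : Injective _≡_ _≡_ (join-map g h)
  injective′ {y} {y'} eq = begin
    y                       ≡⟨ join-splitAt k l y ⟨
    join k l (splitAt k y)  ≡⟨ cong (join k l) (⊎-map-injective g-inj h-inj {splitAt k y} {splitAt k y'} (begin
      Sum.map g h (splitAt k y)                      ≡⟨ splitAt-join i j (Sum.map g h (splitAt k y)) ⟨
      splitAt i (join-map g h y)                     ≡⟨ cong (splitAt i) eq ⟩
      splitAt i (join-map g h y')                    ≡⟨ splitAt-join i j (Sum.map g h (splitAt k y')) ⟩
      Sum.map g h (splitAt k y')                     ∎)) ⟩
    join k l (splitAt k y') ≡⟨ join-splitAt k l y' ⟩
    y'                      ∎
  preserves : ∀ y → join-map g h y ∈ coloops i j ⇔ y ∈ coloops k l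
  preserves y with splitView k l y
  ... | left a rewrite splitAt-↑ˡ k a l = mk⇔ (λ _ → ↑ˡ∈coloops l a) (λ _ → ↑ˡ∈coloops j (g a))
  ... | right b rewrite splitAt-↑ʳ k l b =
    mk⇔ (⊥-elim ∘ ↑ʳ∉coloops i (h b)) (⊥-elim ∘ ↑ʳ∉coloops k b)

join-map-avoids-↑ˡ : ∀ {k l i j} (g : Fin k → Fin i) (h : Fin l → Fin j) {a₀} →
  (∀ a → g a ≢ a₀) → ∀ y → join-map g h y ≢ a₀ ↑ˡ j
join-map-avoids-↑ˡ {k} {l} {i} {j} g h {a₀} g≢a₀ y eq = avoid (splitAt k y) (begin
  Sum.map g h (splitAt k y)   ≡⟨ splitAt-join i j _ ⟨
  splitAt i (join-map g h y)  ≡⟨ cong (splitAt i) eq ⟩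
  splitAt i (a₀ ↑ˡ j)         ≡⟨ splitAt-↑ˡ i a₀ j ⟩
  inj₁ a₀                     ∎)
  where
  open ≡-Reasoning
  avoid : ∀ s → Sum.map g h s ≢ inj₁ a₀
  avoid (inj₁ a) ga≡a₀ = g≢a₀ a (inj₁-injective ga≡a₀)

join-map-avoids-↑ʳ : ∀ {k l i j} (g : Fin k → Fin i) (h : Fin l → Fin j) {b₀} →
  (∀ b → h b ≢ b₀) → ∀ y → join-map g h y ≢ i ↑ʳ b₀
join-map-avoids-↑ʳ {k} {l} {i} {j} g h {b₀} h≢b₀ y eq = avoid (splitAt k y) (begin
  Sum.map g h (splitAt k y)   ≡⟨ splitAt-join i j _ ⟨
  splitAt i (join-map g h y)  ≡⟨ cong (splitAt i) eq ⟩
  splitAt i (i ↑ʳ b₀)         ≡⟨ splitAt-↑ʳ i j b₀ ⟩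
  inj₂ b₀                     ∎)
  where
  open ≡-Reasoning
  avoid : ∀ s → Sum.map g h s ≢ inj₂ b₀
  avoid (inj₂ b) hb≡b₀ = h≢b₀ b (inj₂-injective hb≡b₀)

inject≤≢fromℕ< : ∀ {m n} (a : Fin m) (m<n : m < n) → inject≤ a (<⇒≤ m<n) ≢ fromℕ< m<n
inject≤≢fromℕ< a m<n eq = <⇒≢ (toℕ<n a) (begin
  toℕ a                   ≡⟨ toℕ-inject≤ a (<⇒≤ m<n) ⟨
  toℕ (inject≤ a _)       ≡⟨ cong toℕ eq ⟩
  toℕ (fromℕ< m<n)        ≡⟨ toℕ-fromℕ< m<n ⟩
  _                       ∎)
  where open ≡-Reasoning

inject≤-injective′ : ∀ {m n} (m≤n : m ≤ n) → Injective _≡_ _≡_ (λ a → inject≤ a m≤n)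
inject≤-injective′ m≤n = inject≤-injective m≤n m≤n _ _

>₂⇒avoidingEmbedding : ∀ {i j k l} → (i , j) >₂ (k , l) →
  ∃ λ v → Σ (ColoopsLoopsEmbedding k l i j) λ e → ∀ y → embed e y ≢ v
>₂⇒avoidingEmbedding {i} {j} {k} {l} (k≤i , l≤j , ij≢kl) with k <? i
... | yes k<i = fromℕ< k<i ↑ˡ j , join-map-embedding (inject≤-injective′ k≤i) (inject≤-injective′ l≤j) ,
  join-map-avoids-↑ˡ _ _ (λ a → inject≤≢fromℕ< a k<i)
... | no k≮i = i ↑ʳ fromℕ< l<j , join-map-embedding (inject≤-injective′ k≤i) (inject≤-injective′ l≤j) ,
  join-map-avoids-↑ʳ _ _ (λ b → inject≤≢fromℕ< b l<j)
  where l<j = ≤∧≢⇒< l≤j (λ l≡j → ij≢kl (≤-antisym (≮⇒≥ k≮i) k≤i , sym l≡j))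

¬>₂⇒almostUniform : ∀ {i j k l} → ¬ (i , j) >₂ (k , l) → AlmostUniform k l (coloopsLoops i j)
¬>₂⇒almostUniform {i} {j} ¬>₂ v _ =
  inj₁ (¬>₂ ∘ minor⇒>₂ (∖-restriction (coloopsLoops-restriction i j) ⁅ v ⁆) (λ v∈ → x∈p─q⇒x∉q _ _ v∈ (x∈⁅x⁆ v)))

avoidingEmbedding⇒¬almostUniform : ∀ {i j k l} (e : ColoopsLoopsEmbedding k l i j) {v} →
  (∀ y → embed e y ≢ v) → ¬ AlmostUniform k l (coloopsLoops i j)
avoidingEmbedding⇒¬almostUniform {i} {j} e {v} e≢v almost =
  [ (λ uniform → uniform (embedding⇒minor {P = M ∖ ⁅ v ⁆} (∖-restriction R ⁅ v ⁆) e E∖v))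
  , (λ uniform → uniform (embedding⇒minor {P = M / ⁅ v ⁆} (/-restriction R ⁅v⁆⊆E) e E∖v))
  ]′ (almost v (∈-E-coloopsLoops i j v))
  where
  M = coloopsLoops i j
  R = coloopsLoops-restriction i j
  E∖v : ∀ y → embed e y ∈ E M ─ ⁅ v ⁆
  E∖v y = x∈p∧x≢y⇒x∈p-y (∈-E-coloopsLoops i j _) (e≢v y)
  ⁅v⁆⊆E = from ⁅x⁆⊆p⇔x∈p (∈-E-coloopsLoops i j v)

lemma3p1 : (k l i j : ℕ) → 1 ≤ k → 1 ≤ l →
    (¬ AlmostUniform k l (U i i ⊕ U 0 j)) ⇔ ((i , j) >₂ (k , l))
lemma3p1 k l i j _ _ = mk⇔
  (λ ¬almost → decidable-stable ((i , j) >₂? (k , l)) (¬almost ∘ ¬>₂⇒almostUniform))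
  (λ >₂ → let v , e , e≢v = >₂⇒avoidingEmbedding >₂ in avoidingEmbedding⇒¬almostUniform e e≢v)
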